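{- Let $A$ be a valise $(4,1)$ adinkra and let $I,J,K,L$ be an enumeration of $\{1,2,3,4\}$ (all distinct). Then (1) $\pi_{IJ}=\pi_{KL}$; and (2) $\pi_{IJ}\pi_{IK}=\pi_{JK}=\pi_{IL}$.
   Context: Vertices: bosons $B=\{b_1,\dots,b_4\}$, fermions $F=\{f_1,\dots,f_4\}$. A valise $(4,1)$ adinkra is $K_{4,4}$ between $B$ and $F$ with edges colored by $\{1,2,3,4\}$ (each vertex has one edge of each color; any two colors form a disjoint union of $4$-cycles) and an odd dashing (every two-colored $4$-cycle has an odd number of dashed edges). For color $I$, $\pi_I$ is the permutation operator on $\mathbf{C}^{B\cup F}$ sending each vertex to its neighbor along the edge of color $I$ (ignoring dashing), and $\pi_{IJ}=\pi_I\pi_J$. -}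

module Defs where

open import Data.Fin using (Fin; zero; suc; _≟_)
open import Data.Sum using (_⊎_; inj₁; inj₂)
open import Data.Bool using (Bool; true; false; if_then_else_; _xor_)
open import Data.Product using (_×_)
open import Function.Definitions using (Injective)
open import Relation.Binary.PropositionalEquality using (_≡_; _≢_)
open import Relation.Nullary.Decidable using (does)

Color Boson Fermion : Set
Color   = Fin 4
Boson   = Fin 4
Fermion = Fin 4

Vertex : Set
Vertex = Boson ⊎ Fermion

-- Inverse of a map Fin 4 → Fin 4 by exhaustive search
-- (correct whenever the map is a bijection).
inv : (Fin 4 → Fin 4) → Fin 4 → Fin 4
inv g f =
  if does (g zero ≟ f) then zero else
  if does (g (suc zero) ≟ f) then suc zero else
  if does (g (suc (suc zero)) ≟ f) then suc (suc zero) else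
  suc (suc (suc zero))

-- Every edge is (b , nbr c b) with color c, so edges are indexed by (c , b);
-- dashed c b says whether that edge is dashed.
record ColoredDashedGraph : Set where
  field
    nbr    : Color → Boson → Fermion
    dashed : Color → Boson → Bool

module _ (G : ColoredDashedGraph) where
  open ColoredDashedGraph G

  πv : Color → Vertex → Vertex
  πv c (inj₁ b) = inj₂ (nbr c b)
  πv c (inj₂ f) = inj₁ (inv (nbr c) f)

  step : Color → Color → Boson → Boson
  step I J b = inv (nbr J) (nbr I b)

  record IsValiseAdinkra : Set where
    field
      -- each fermion has exactly one edge of each color
      -- (color-c edges form a perfect matching)
      matching   : ∀ c → Injective _≡_ _≡_ (nbr c)
      -- the underlying graph is K_{4,4}: boson b is joined to every fermion
      -- exactly once, i.e. its four differently colored edges go to distinct fermions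
      complete   : ∀ b → Injective _≡_ _≡_ (λ c → nbr c b)
      -- any two colors I ≠ J form a disjoint union of 4-cycles:
      -- alternately following I and J returns to the start after 4 steps
      fourCycles : ∀ I J → I ≢ J → ∀ v → πv J (πv I (πv J (πv I v))) ≡ v
      -- odd dashing: the two-colored 4-cycle through boson b with colors I, J
      -- has edges (I,b), (J,b'), (I,b'), (J,b) with b' = step I J b;
      -- an odd number of them is dashed
      oddDashing : ∀ I J → I ≢ J → ∀ b →
        (dashed I b xor dashed J (step I J b)) xor
        (dashed I (step I J b) xor dashed J b) ≡ true

πIJ : ColoredDashedGraph → Color → Color → Vertex → Vertex
πIJ G I J v = πv G I (πv G J v)

-- On each of the classes B and F let s I J send a vertex along colour I and back
-- along colour J, so that π_{IJ} acts there as s J I.  Then s I I = id,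
-- s J K ∘ s I J = s I K, s I J is an involution for I ≠ J (two-coloured 4-cycles), and
-- s I J x ≠ s I K x for J ≠ K (the graph is K_{4,4}).
-- Fixing I and x, the four points s I M x therefore exhaust the class, and
-- s I J (s I K x) differs from x, s I J x and s I K x, so it is the fourth, s I L x.
-- Conjugating by s K I turns this into s I J = s K L; the rest is s I J = s J I
-- combined with the composition law.
module Submission where

open import Defs
open import Data.Fin using (Fin; zero; suc; _≟_)
open import Data.Fin.Properties using (all?)
open import Data.Product using (_×_; _,_)
open import Data.Sum using (inj₁; inj₂)
open import Function.Consequences.Propositional using (contraInjective)
open import Function.Definitions using (Injective)
open import Relation.Binary.PropositionalEquality
  using (_≡_; _≢_; refl; sym; trans; cong; ≢-sym; module ≡-Reasoning)
open import Relation.Nullary using (yes; no; ¬?)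
open import Relation.Nullary.Decidable using (from-yes; _→-dec_)

fourth-of-four : ∀ (a b c d x : Fin 4) →
  a ≢ b → a ≢ c → a ≢ d → b ≢ c → b ≢ d → c ≢ d →
  x ≢ a → x ≢ b → x ≢ c → x ≡ d
fourth-of-four = from-yes (
  all? {n = 4} λ a → all? {n = 4} λ b → all? {n = 4} λ c →
  all? {n = 4} λ d → all? {n = 4} λ x →
  ¬? (a ≟ b) →-dec ¬? (a ≟ c) →-dec ¬? (a ≟ d) →-dec ¬? (b ≟ c) →-dec
  ¬? (b ≟ d) →-dec ¬? (c ≟ d) →-dec ¬? (x ≟ a) →-dec ¬? (x ≟ b) →-dec
  ¬? (x ≟ c) →-dec x ≟ d)

injective-fourth : ∀ {g : Fin 4 → Fin 4} → Injective _≡_ _≡_ g → ∀ (a b c d : Fin 4) →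
  a ≢ b → a ≢ c → a ≢ d → b ≢ c → b ≢ d → c ≢ d →
  ∀ {x} → x ≢ g a → x ≢ g b → x ≢ g c → x ≡ g d
injective-fourth {g} g-inj a b c d ab ac ad bc bd cd =
  fourth-of-four (g a) (g b) (g c) (g d) _
    (distinct ab) (distinct ac) (distinct ad) (distinct bc) (distinct bd) (distinct cd)
  where
  distinct : ∀ {i j} → i ≢ j → g i ≢ g j
  distinct = contraInjective g-inj

module _ {g : Fin 4 → Fin 4} (g-inj : Injective _≡_ _≡_ g) where

  inv-rightInverse : ∀ y → g (inv g y) ≡ y
  inv-rightInverse y with g zero ≟ y
  ... | yes g0≡y = g0≡y
  ... | no g0≢y with g (suc zero) ≟ y
  ...   | yes g1≡y = g1≡y
  ...   | no g1≢y with g (suc (suc zero)) ≟ y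
  ...     | yes g2≡y = g2≡y
  ...     | no g2≢y = sym (injective-fourth g-inj
              zero (suc zero) (suc (suc zero)) (suc (suc (suc zero)))
              (λ ()) (λ ()) (λ ()) (λ ()) (λ ()) (λ ())
              (≢-sym g0≢y) (≢-sym g1≢y) (≢-sym g2≢y))

  inv-leftInverse : ∀ x → inv g (g x) ≡ x
  inv-leftInverse x = g-inj (inv-rightInverse (g x))

module Transitions
  (s : Color → Color → Fin 4 → Fin 4)
  (s-refl : ∀ I x → s I I x ≡ x)
  (s-trans : ∀ I J K x → s J K (s I J x) ≡ s I K x)
  (s-involutive : ∀ I J → I ≢ J → ∀ x → s I J (s I J x) ≡ x)
  (s-injective-in-target : ∀ I x → Injective _≡_ _≡_ (λ J → s I J x))
  where

  s-distinct : ∀ {I J K} → J ≢ K → ∀ x → s I J x ≢ s I K x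
  s-distinct {I} J≢K x = contraInjective (s-injective-in-target I x) J≢K

  s-moves : ∀ {I J} → I ≢ J → ∀ x → s I J x ≢ x
  s-moves {I} {J} I≢J x p = s-distinct (≢-sym I≢J) x (trans p (sym (s-refl I x)))

  s-injective : ∀ {I J} → I ≢ J → Injective _≡_ _≡_ (s I J)
  s-injective {I} {J} I≢J {x} {y} p = begin
    x               ≡⟨ sym (s-involutive I J I≢J x) ⟩
    s I J (s I J x) ≡⟨ cong (s I J) p ⟩
    s I J (s I J y) ≡⟨ s-involutive I J I≢J y ⟩
    y               ∎
    where open ≡-Reasoning

  s-sym : ∀ {I J} → I ≢ J → ∀ x → s J I x ≡ s I J x
  s-sym {I} {J} I≢J x = begin
    s J I x                   ≡⟨ cong (s J I) (sym (s-involutive I J I≢J x)) ⟩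
    s J I (s I J (s I J x))   ≡⟨ s-trans I J I (s I J x) ⟩
    s I I (s I J x)           ≡⟨ s-refl I (s I J x) ⟩
    s I J x                   ∎
    where open ≡-Reasoning

  s-trans-sym : ∀ {I J K} → I ≢ J → ∀ x → s J I (s K I x) ≡ s K J x
  s-trans-sym {I} {J} {K} I≢J x = trans (s-sym I≢J (s K I x)) (s-trans K I J x)

  s-third : ∀ {I J K L} → I ≢ J → I ≢ K → I ≢ L → J ≢ K → J ≢ L → K ≢ L →
    ∀ x → s I J (s I K x) ≡ s I L x
  s-third {I} {J} {K} {L} ij ik il jk jl kl x =
    injective-fourth (s-injective-in-target I x) I J K L ij ik il jk jl kl
      avoids-x avoids-sIJx (s-moves ij (s I K x))
    where
    avoids-x : s I J (s I K x) ≢ s I I x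
    avoids-x p = s-distinct (≢-sym jk) x
      (trans (sym (s-involutive I J ij (s I K x))) (cong (s I J) (trans p (s-refl I x))))

    avoids-sIJx : s I J (s I K x) ≢ s I J x
    avoids-sIJx p = s-moves ik x (s-injective ij p)

  s-complementary : ∀ {I J K L} → I ≢ J → I ≢ K → I ≢ L → J ≢ K → J ≢ L → K ≢ L →
    ∀ x → s I J x ≡ s K L x
  s-complementary {I} {J} {K} {L} ij ik il jk jl kl x = begin
    s I J x                   ≡⟨ cong (s I J) (sym (s-refl K x)) ⟩
    s I J (s K K x)           ≡⟨ cong (s I J) (sym (s-trans K I K x)) ⟩
    s I J (s I K (s K I x))   ≡⟨ s-third ij ik il jk jl kl (s K I x) ⟩
    s I L (s K I x)           ≡⟨ s-trans K I L x ⟩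
    s K L x                   ∎
    where open ≡-Reasoning

module _ (G : ColoredDashedGraph) (A : IsValiseAdinkra G) where
  open ColoredDashedGraph G
  open IsValiseAdinkra A

  fermionStep : Color → Color → Fermion → Fermion
  fermionStep I J f = nbr J (inv (nbr I) f)

  private
    inj₁-injective : ∀ {b b′ : Boson} → _≡_ {A = Vertex} (inj₁ b) (inj₁ b′) → b ≡ b′
    inj₁-injective refl = refl

    inj₂-injective : ∀ {f f′ : Fermion} → _≡_ {A = Vertex} (inj₂ f) (inj₂ f′) → f ≡ f′
    inj₂-injective refl = refl

    nbr-inv : ∀ I f → nbr I (inv (nbr I) f) ≡ f
    nbr-inv I = inv-rightInverse (matching I)

    inv-nbr : ∀ I b → inv (nbr I) (nbr I b) ≡ b
    inv-nbr I = inv-leftInverse (matching I)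

  module Bosonic = Transitions (step G)
    inv-nbr
    (λ I J K b → cong (inv (nbr K)) (nbr-inv J (nbr I b)))
    (λ I J I≢J b → inj₁-injective (fourCycles I J I≢J (inj₁ b)))
    (λ I b {J} {K} p → complete (step G I J b)
      (trans (nbr-inv J (nbr I b)) (sym (trans (cong (nbr K) p) (nbr-inv K (nbr I b))))))

  module Fermionic = Transitions fermionStep
    nbr-inv
    (λ I J K f → cong (nbr K) (inv-nbr J (inv (nbr I) f)))
    (λ I J I≢J f → inj₂-injective (fourCycles I J I≢J (inj₂ f)))
    (λ I f → complete (inv (nbr I) f))

  π-complementary : ∀ {I J K L} → I ≢ J → I ≢ K → I ≢ L → J ≢ K → J ≢ L → K ≢ L →
    ∀ v → πIJ G I J v ≡ πIJ G K L v
  π-complementary ij ik il jk jl kl (inj₁ b) = cong inj₁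
    (Bosonic.s-complementary (≢-sym ij) jl jk il ik (≢-sym kl) b)
  π-complementary ij ik il jk jl kl (inj₂ f) = cong inj₂
    (Fermionic.s-complementary (≢-sym ij) jl jk il ik (≢-sym kl) f)

  π-trans : ∀ {I J K} → I ≢ J → ∀ v → πIJ G I J (πIJ G I K v) ≡ πIJ G J K v
  π-trans I≢J (inj₁ b) = cong inj₁ (Bosonic.s-trans-sym I≢J b)
  π-trans I≢J (inj₂ f) = cong inj₂ (Fermionic.s-trans-sym I≢J f)

lemma3p4 : (G : ColoredDashedGraph) → IsValiseAdinkra G →
    (I J K L : Color) →
    I ≢ J → I ≢ K → I ≢ L → J ≢ K → J ≢ L → K ≢ L →
    (∀ v → πIJ G I J v ≡ πIJ G K L v) ×
    ((∀ v → πIJ G I J (πIJ G I K v) ≡ πIJ G J K v) ×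
     (∀ v → πIJ G J K v ≡ πIJ G I L v))
lemma3p4 G A I J K L ij ik il jk jl kl =
  π-complementary G A ij ik il jk jl kl ,
  π-trans G A ij ,
  π-complementary G A jk (≢-sym ij) jl (≢-sym ik) kl il
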